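{- Let $(P,s)$ be a substitution rule with $P$ nonempty such that for every $(G,\varphi)\in P$ the word $\varphi(s)$ is nonempty and reduced with respect to $G$. Then $(P,s)$ is not local (i.e. it is global).
   Context: Local complementation of a simple graph: $Gu$ has edge set $E(G)\triangle\{[x,y]:x\ne y\in N_G(u)\}$; $Gu_1\cdots u_k=(\cdots(Gu_1)\cdots)u_k$. A word $t$ over $V(G)$ is reduced with respect to $G$ if $t=t_1\cdots t_n$ where the letter sets of the blocks $t_i$ are pairwise disjoint and each $t_i$ is either a single vertex or a word $uvu$ with $u\ne v$, $[u,v]\in E(Gt_1\cdots t_{i-1})$. A substitution rule is a pair $(P,s)$ where $s$ is a word over a finite set $X$ of vertex variables and $P$ is a class of pairs $(G,\varphi)$, $G$ a simple graph and $\varphi:X\to V(G)$, such that $G\varphi(s)=G$ for all $(G,\varphi)\in P$ ($\varphi(s)$ is obtained by substituting letterwise). The rule is local if for every $(G,\varphi)\in P$ and every simple graph $H$ containing $G$ as an induced subgraph, $H\varphi(s)=H$; otherwise it is global. -}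

module Defs where

open import Data.Bool using (Bool; true; false; not; _∧_; if_then_else_)
open import Data.Nat using (ℕ)
open import Data.Fin using (Fin; _≟_)
open import Data.List using (List; []; _∷_; concatMap)
open import Data.List.Relation.Unary.AllPairs using (AllPairs)
open import Data.List.Relation.Binary.Disjoint.Propositional using (Disjoint)
open import Data.Product using (Σ; _×_; ∃; ∃-syntax)
open import Data.Unit using (⊤)
open import Relation.Binary.PropositionalEquality using (_≡_; _≢_)
open import Relation.Nullary using (¬_; yes; no)
open import Function.Definitions using (Injective)

Adj : ℕ → Set
Adj n = Fin n → Fin n → Bool

record SimpleGraph (n : ℕ) : Set where
  field
    adj    : Adj n
    sym    : ∀ x y → adj x y ≡ adj y x
    irrefl : ∀ x → adj x x ≡ false
open SimpleGraph public

lc : ∀ {n} → Adj n → Fin n → Adj n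
lc A u x y with x ≟ y
... | yes _ = A x y
... | no  _ = if A u x ∧ A u y then not (A x y) else A x y

lcWord : ∀ {n} → Adj n → List (Fin n) → Adj n
lcWord A []       = A
lcWord A (u ∷ us) = lcWord (lc A u) us

_≐_ : ∀ {n} → Adj n → Adj n → Set
A ≐ B = ∀ x y → A x y ≡ B x y

-- Blocks of a reduced word: a single vertex u, or the word u v u.
data Block (n : ℕ) : Set where
  single : Fin n → Block n
  triple : Fin n → Fin n → Block n

blockWord : ∀ {n} → Block n → List (Fin n)
blockWord (single u)   = u ∷ []
blockWord (triple u v) = u ∷ v ∷ u ∷ []

blockLetters : ∀ {n} → Block n → List (Fin n)
blockLetters (single u)   = u ∷ []
blockLetters (triple u v) = u ∷ v ∷ []

ValidBlock : ∀ {n} → Adj n → Block n → Set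
ValidBlock A (single u)   = ⊤
ValidBlock A (triple u v) = u ≢ v × A u v ≡ true

ValidBlocks : ∀ {n} → Adj n → List (Block n) → Set
ValidBlocks A []       = ⊤
ValidBlocks A (b ∷ bs) = ValidBlock A b × ValidBlocks (lcWord A (blockWord b)) bs

Reduced : ∀ {n} → SimpleGraph n → List (Fin n) → Set
Reduced G t = ∃[ bs ] (concatMap blockWord bs ≡ t
                      × AllPairs (λ b c → Disjoint (blockLetters b) (blockLetters c)) bs
                      × ValidBlocks (adj G) bs)

subst : ∀ {k n} → (Fin k → Fin n) → List (Fin k) → List (Fin n)
subst φ []       = []
subst φ (x ∷ s)  = φ x ∷ subst φ s

-- A class P of pairs (G , φ) with φ : X → V(G), X = Fin k.
GraphClass : ℕ → Set₁
GraphClass k = ∀ n → SimpleGraph n → (Fin k → Fin n) → Set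

IsSubstitutionRule : ∀ {k} → GraphClass k → List (Fin k) → Set
IsSubstitutionRule {k} P s =
  ∀ n (G : SimpleGraph n) (φ : Fin k → Fin n) → P n G φ →
    lcWord (adj G) (subst φ s) ≐ adj G

InducedEmbedding : ∀ {n m} → SimpleGraph n → SimpleGraph m → (Fin n → Fin m) → Set
InducedEmbedding G H ι = Injective _≡_ _≡_ ι × (∀ x y → adj H (ι x) (ι y) ≡ adj G x y)

IsLocal : ∀ {k} → GraphClass k → List (Fin k) → Set
IsLocal {k} P s =
  ∀ n (G : SimpleGraph n) (φ : Fin k → Fin n) → P n G φ →
  ∀ m (H : SimpleGraph m) (ι : Fin n → Fin m) → InducedEmbedding G H ι →
    lcWord (adj H) (subst (λ x → ι (φ x)) s) ≐ adj H

module Submission where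

-- Let φ(s) = t₁ ⋯ tₘ be reduced and let c be the first letter of the last block tₘ. Embed G
-- in H by attaching two new vertices p, q adjacent only to c. The letters of t₁ ⋯ tₘ₋₁ avoid c,
-- and local complementation at a vertex other than c leaves the edges at p and q alone, so
-- H t₁ ⋯ tₘ₋₁ is G t₁ ⋯ tₘ₋₁ with p, q attached to c. The last block then alters the pendant
-- edges: a single c joins p to q, and a pivot c v c along the edge cv removes the edge pc.
-- Hence H φ(s) ≠ H.

open import Defs hiding (sym)
open import Data.Bool using (Bool; true; false; _∧_; _xor_)
open import Data.Bool.Properties using (∧-comm; ∧-zeroʳ)
open import Data.Empty using (⊥-elim)
open import Function using (case_of_)
open import Data.Fin using (Fin; zero; suc; _↑ʳ_; _≟_)
open import Data.Fin.Properties using (↑ʳ-injective)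
open import Data.List using (List; []; _∷_; _++_; map; concatMap)
open import Data.List.Properties using (map-++; ++-identityʳ)
open import Data.List.Membership.Propositional using (_∈_; _∉_)
open import Data.List.Relation.Unary.All using (lookupAny)
open import Data.List.Relation.Unary.Any using (Any; here; there)
open import Data.List.Relation.Unary.AllPairs using (AllPairs; _∷_)
open import Data.List.Relation.Binary.Disjoint.Propositional using (Disjoint)
open import Data.Nat using (ℕ; _+_)
open import Data.Product using (Σ; _×_; _,_; ∃-syntax)
open import Data.Sum using (_⊎_; inj₁; inj₂)
open import Relation.Binary.PropositionalEquality using (_≡_; _≢_; refl; sym; trans; cong; cong₂; module ≡-Reasoning)
open import Relation.Nullary using (¬_; yes; no; does)
open import Relation.Nullary.Decidable using (dec-true; dec-false)

private
  variable
    n : ℕ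

Symmetric : Adj n → Set
Symmetric A = ∀ x y → A x y ≡ A y x

Loopless : Adj n → Set
Loopless A = ∀ x → A x x ≡ false

lc-diag : (A : Adj n) (u x : Fin n) → lc A u x x ≡ A x x
lc-diag A u x with x ≟ x
... | yes _   = refl
... | no x≢x = ⊥-elim (x≢x refl)

lc-≢ : (A : Adj n) (u : Fin n) {x y : Fin n} → x ≢ y →
       lc A u x y ≡ (A u x ∧ A u y) xor A x y
lc-≢ A u {x} {y} x≢y with x ≟ y
... | yes x≡y = ⊥-elim (x≢y x≡y)
... | no _ with A u x ∧ A u y
...   | true  = refl
...   | false = refl

lc-≢-eval : (A : Adj n) (u x y : Fin n) {a b r : Bool} → x ≢ y →
            A u x ≡ a → A u y ≡ b → A x y ≡ r → lc A u x y ≡ (a ∧ b) xor r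
lc-≢-eval A u x y x≢y refl refl refl = lc-≢ A u x≢y

lc-fixes-nonNeighbourˡ : (A : Adj n) (u x : Fin n) → A u x ≡ false → ∀ y → lc A u x y ≡ A x y
lc-fixes-nonNeighbourˡ A u x Aux y = case x ≟ y of λ where
  (yes refl) → lc-diag A u x
  (no x≢y)   → lc-≢-eval A u x y x≢y Aux refl refl

lc-fixes-nonNeighbourʳ : (A : Adj n) (u y : Fin n) → A u y ≡ false → ∀ x → lc A u x y ≡ A x y
lc-fixes-nonNeighbourʳ A u y Auy x = case x ≟ y of λ where
  (yes refl) → lc-diag A u x
  (no x≢y)   → trans (lc-≢-eval A u x y x≢y refl Auy refl) (cong (_xor A x y) (∧-zeroʳ (A u x)))

lc-cong : {A B : Adj n} → A ≐ B → ∀ u → lc A u ≐ lc B u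
lc-cong {A = A} {B} A≐B u x y = case x ≟ y of λ where
  (yes refl) → trans (lc-diag A u x) (trans (A≐B x x) (sym (lc-diag B u x)))
  (no x≢y)   → trans (lc-≢ A u x≢y)
                   (trans (cong₂ _xor_ (cong₂ _∧_ (A≐B u x) (A≐B u y)) (A≐B x y))
                          (sym (lc-≢ B u x≢y)))

lc-symmetric : {A : Adj n} → Symmetric A → ∀ u → Symmetric (lc A u)
lc-symmetric {A = A} symA u x y = case x ≟ y of λ where
  (yes refl) → refl
  (no x≢y)   → trans (lc-≢ A u x≢y)
                   (trans (cong₂ _xor_ (∧-comm (A u x) (A u y)) (symA x y))
                          (sym (lc-≢ A u (λ y≡x → x≢y (sym y≡x)))))

lcWord-cong : {A B : Adj n} → A ≐ B → ∀ w → lcWord A w ≐ lcWord B w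
lcWord-cong A≐B []      = A≐B
lcWord-cong A≐B (u ∷ w) = lcWord-cong (lc-cong A≐B u) w

lcWord-++ : (A : Adj n) (v w : List (Fin n)) → lcWord A (v ++ w) ≡ lcWord (lcWord A v) w
lcWord-++ A []      w = refl
lcWord-++ A (u ∷ v) w = lcWord-++ (lc A u) v w

lcWord-symmetric : {A : Adj n} → Symmetric A → ∀ w → Symmetric (lcWord A w)
lcWord-symmetric symA []      = symA
lcWord-symmetric symA (u ∷ w) = lcWord-symmetric (lc-symmetric symA u) w

lcWord-diag : (A : Adj n) (w : List (Fin n)) (x : Fin n) → lcWord A w x x ≡ A x x
lcWord-diag A []      x = refl
lcWord-diag A (u ∷ w) x = trans (lcWord-diag (lc A u) w x) (lc-diag A u x)

lcWord-loopless : {A : Adj n} → Loopless A → ∀ w → Loopless (lcWord A w)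
lcWord-loopless {A = A} loopA w x = trans (lcWord-diag A w x) (loopA x)

-- The new vertices are 0 and 1; a vertex x of the original graph becomes 2 ↑ʳ x.
attachPendants : Adj n → Fin n → Adj (2 + n)
attachPendants A c (suc (suc x)) (suc (suc y)) = A x y
attachPendants A c (suc (suc x)) _             = does (c ≟ x)
attachPendants A c _             (suc (suc y)) = does (c ≟ y)
attachPendants A c _             _             = false

attachPendants-symmetric : {A : Adj n} (c : Fin n) → Symmetric A → Symmetric (attachPendants A c)
attachPendants-symmetric c symA zero          zero          = refl
attachPendants-symmetric c symA zero          (suc zero)    = refl
attachPendants-symmetric c symA zero          (suc (suc y)) = refl
attachPendants-symmetric c symA (suc zero)    zero          = refl
attachPendants-symmetric c symA (suc zero)    (suc zero)    = refl
attachPendants-symmetric c symA (suc zero)    (suc (suc y)) = refl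
attachPendants-symmetric c symA (suc (suc x)) zero          = refl
attachPendants-symmetric c symA (suc (suc x)) (suc zero)    = refl
attachPendants-symmetric c symA (suc (suc x)) (suc (suc y)) = symA x y

attachPendants-loopless : {A : Adj n} (c : Fin n) → Loopless A → Loopless (attachPendants A c)
attachPendants-loopless c loopA zero          = refl
attachPendants-loopless c loopA (suc zero)    = refl
attachPendants-loopless c loopA (suc (suc x)) = loopA x

withPendants : SimpleGraph n → Fin n → SimpleGraph (2 + n)
withPendants G c = record
  { adj    = attachPendants (adj G) c
  ; sym    = attachPendants-symmetric c (SimpleGraph.sym G)
  ; irrefl = attachPendants-loopless c (irrefl G) }

withPendants-inducedEmbedding : (G : SimpleGraph n) (c : Fin n) → InducedEmbedding G (withPendants G c) (2 ↑ʳ_)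
withPendants-inducedEmbedding G c = ↑ʳ-injective 2 _ _ , λ x y → refl

lc-attachPendants : (A : Adj n) {c u : Fin n} → u ≢ c →
                    lc (attachPendants A c) (2 ↑ʳ u) ≐ attachPendants (lc A u) c
lc-attachPendants A {c} {u} u≢c = commute
  where
  B = attachPendants A c
  c≁u : does (c ≟ u) ≡ false
  c≁u = dec-false (c ≟ u) (λ c≡u → u≢c (sym c≡u))
  commute : lc B (2 ↑ʳ u) ≐ attachPendants (lc A u) c
  commute zero          zero          = lc-fixes-nonNeighbourˡ B (2 ↑ʳ u) zero c≁u zero
  commute zero          (suc zero)    = lc-fixes-nonNeighbourˡ B (2 ↑ʳ u) zero c≁u (suc zero)
  commute zero          (suc (suc y)) = lc-fixes-nonNeighbourˡ B (2 ↑ʳ u) zero c≁u (suc (suc y))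
  commute (suc zero)    zero          = lc-fixes-nonNeighbourˡ B (2 ↑ʳ u) (suc zero) c≁u zero
  commute (suc zero)    (suc zero)    = lc-fixes-nonNeighbourˡ B (2 ↑ʳ u) (suc zero) c≁u (suc zero)
  commute (suc zero)    (suc (suc y)) = lc-fixes-nonNeighbourˡ B (2 ↑ʳ u) (suc zero) c≁u (suc (suc y))
  commute (suc (suc x)) zero          = lc-fixes-nonNeighbourʳ B (2 ↑ʳ u) zero c≁u (suc (suc x))
  commute (suc (suc x)) (suc zero)    = lc-fixes-nonNeighbourʳ B (2 ↑ʳ u) (suc zero) c≁u (suc (suc x))
  commute (suc (suc x)) (suc (suc y)) with x ≟ y
  ... | yes _ = refl
  ... | no _  = refl

lcWord-attachPendants : (A : Adj n) {c : Fin n} (w : List (Fin n)) → c ∉ w →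
                        lcWord (attachPendants A c) (map (2 ↑ʳ_) w) ≐ attachPendants (lcWord A w) c
lcWord-attachPendants A []      c∉w x y = refl
lcWord-attachPendants A (u ∷ w) c∉w x y =
  trans (lcWord-cong (lc-attachPendants A (λ u≡c → c∉w (here (sym u≡c)))) (map (2 ↑ʳ_) w) x y)
        (lcWord-attachPendants (lc A u) w (λ c∈w → c∉w (there c∈w)) x y)

PendantsDisturbed : Adj (2 + n) → Fin n → Set
PendantsDisturbed B c = B zero (suc zero) ≡ true ⊎ B zero (2 ↑ʳ c) ≡ false

pendantsDisturbed-resp-≐ : {B B′ : Adj (2 + n)} {c : Fin n} → B ≐ B′ →
                           PendantsDisturbed B′ c → PendantsDisturbed B c
pendantsDisturbed-resp-≐ B≐B′ (inj₁ 0~1) = inj₁ (trans (B≐B′ zero (suc zero)) 0~1)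
pendantsDisturbed-resp-≐ B≐B′ (inj₂ 0≁c) = inj₂ (trans (B≐B′ zero _) 0≁c)

pendantsDisturbed⇒¬≐attachPendants : {B : Adj (2 + n)} {A : Adj n} {c : Fin n} →
                                      PendantsDisturbed B c → ¬ (B ≐ attachPendants A c)
pendantsDisturbed⇒¬≐attachPendants (inj₁ 0~1) B≐ with trans (sym 0~1) (B≐ zero (suc zero))
... | ()
pendantsDisturbed⇒¬≐attachPendants {c = c} (inj₂ 0≁c) B≐
  with trans (sym (dec-true (c ≟ c) refl)) (trans (sym (B≐ zero (2 ↑ʳ c))) 0≁c)
... | ()

leader : Block n → Fin n
leader (single u)   = u
leader (triple u _) = u

leader∈blockLetters : (b : Block n) → leader b ∈ blockLetters b
leader∈blockLetters (single u)   = here refl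
leader∈blockLetters (triple u v) = here refl

blockWord⊆blockLetters : (b : Block n) {x : Fin n} → x ∈ blockWord b → x ∈ blockLetters b
blockWord⊆blockLetters (single u)   x∈b                         = x∈b
blockWord⊆blockLetters (triple u v) (here x≡u)                  = here x≡u
blockWord⊆blockLetters (triple u v) (there (here x≡v))          = there (here x≡v)
blockWord⊆blockLetters (triple u v) (there (there (here x≡u))) = here x≡u

block-disturbsPendants : {A : Adj n} → Symmetric A → Loopless A → (b : Block n) → ValidBlock A b →
  PendantsDisturbed (lcWord (attachPendants A (leader b)) (map (2 ↑ʳ_) (blockWord b))) (leader b)
block-disturbsPendants {A = A} symA loopA (single c) _ =
  inj₁ (lc-≢-eval (attachPendants A c) (2 ↑ʳ c) zero (suc zero) (λ ()) c~p c~p refl)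
  where
  c~p : does (c ≟ c) ≡ true
  c~p = dec-true (c ≟ c) refl
block-disturbsPendants {A = A} symA loopA (triple c v) (c≢v , c~v) = inj₂ pc₃
  where
  c~p : does (c ≟ c) ≡ true
  c~p = dec-true (c ≟ c) refl
  c′ v′ : Fin (2 + _)
  c′ = 2 ↑ʳ c
  v′ = 2 ↑ʳ v
  H₀ = attachPendants A c
  H₁ = lc H₀ c′
  H₂ = lc H₁ v′
  pc₁ : H₁ zero c′ ≡ true
  pc₁ = lc-≢-eval H₀ c′ zero c′ (λ ()) c~p (loopA c) c~p
  vp₁ : H₁ v′ zero ≡ true
  vp₁ = lc-≢-eval H₀ c′ v′ zero (λ ()) c~v c~p (dec-false (c ≟ v) c≢v)
  vc₁ : H₁ v′ c′ ≡ true
  vc₁ = lc-≢-eval H₀ c′ v′ c′ (λ v′≡c′ → c≢v (sym (↑ʳ-injective 2 v c v′≡c′)))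
                  c~v (loopA c) (trans (symA v c) c~v)
  pc₂ : H₂ zero c′ ≡ false
  pc₂ = lc-≢-eval H₁ v′ zero c′ (λ ()) vp₁ vc₁ pc₁
  cc₂ : H₂ c′ c′ ≡ false
  cc₂ = lcWord-loopless (attachPendants-loopless c loopA) (c′ ∷ v′ ∷ []) c′
  pc₃ : lc H₂ c′ zero c′ ≡ false
  pc₃ = trans (lc-≢-eval H₂ c′ zero c′ (λ ()) refl cc₂ pc₂) (cong (_xor false) (∧-zeroʳ (H₂ c′ zero)))

DisjointLetters : Block n → Block n → Set
DisjointLetters b b′ = Disjoint (blockLetters b) (blockLetters b′)

blocks-disturbPendants : {A : Adj n} → Symmetric A → Loopless A → (b : Block n) (bs : List (Block n)) →
  AllPairs DisjointLetters (b ∷ bs) → ValidBlocks A (b ∷ bs) →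
  ∃[ c ] Any (λ b′ → c ∈ blockLetters b′) (b ∷ bs)
       × PendantsDisturbed (lcWord (attachPendants A c) (map (2 ↑ʳ_) (concatMap blockWord (b ∷ bs)))) c
blocks-disturbPendants symA loopA b [] _ (valid , _) rewrite ++-identityʳ (blockWord b) =
  leader b , here (leader∈blockLetters b) , block-disturbsPendants symA loopA b valid
blocks-disturbPendants {A = A} symA loopA b (b₂ ∷ bs) (b#bs ∷ pairs) (valid , valids)
  with blocks-disturbPendants (lcWord-symmetric symA (blockWord b)) (lcWord-loopless loopA (blockWord b))
                              b₂ bs pairs valids
... | c , c∈bs , disturbed = c , there c∈bs , pendantsDisturbed-resp-≐ prefix disturbed
  where
  w r : List (Fin _)
  w = blockWord b
  r = concatMap blockWord (b₂ ∷ bs)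
  c∉w : c ∉ w
  c∉w c∈w = let b#b′ , c∈b′ = lookupAny b#bs c∈bs in b#b′ (blockWord⊆blockLetters b c∈w , c∈b′)
  H = attachPendants A c
  prefix : lcWord H (map (2 ↑ʳ_) (w ++ r)) ≐ lcWord (attachPendants (lcWord A w) c) (map (2 ↑ʳ_) r)
  prefix x y = begin
    lcWord H (map (2 ↑ʳ_) (w ++ r)) x y
      ≡⟨ cong (λ t → lcWord H t x y) (map-++ (2 ↑ʳ_) w r) ⟩
    lcWord H (map (2 ↑ʳ_) w ++ map (2 ↑ʳ_) r) x y
      ≡⟨ cong (λ B → B x y) (lcWord-++ H (map (2 ↑ʳ_) w) (map (2 ↑ʳ_) r)) ⟩
    lcWord (lcWord H (map (2 ↑ʳ_) w)) (map (2 ↑ʳ_) r) x y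
      ≡⟨ lcWord-cong (lcWord-attachPendants A w c∉w) (map (2 ↑ʳ_) r) x y ⟩
    lcWord (attachPendants (lcWord A w) c) (map (2 ↑ʳ_) r) x y ∎
    where open ≡-Reasoning

reduced-disturbsPendants : (G : SimpleGraph n) {t : List (Fin n)} → t ≢ [] → Reduced G t →
  ∃[ c ] PendantsDisturbed (lcWord (attachPendants (adj G) c) (map (2 ↑ʳ_) t)) c
reduced-disturbsPendants G t≢[] ([] , t≡[] , _) = ⊥-elim (t≢[] (sym t≡[]))
reduced-disturbsPendants G t≢[] (b ∷ bs , refl , pairs , valid)
  with blocks-disturbPendants (SimpleGraph.sym G) (irrefl G) b bs pairs valid
... | c , _ , disturbed = c , disturbed

subst-∘ : ∀ {k m} (φ : Fin k → Fin n) (ι : Fin n → Fin m) (s : List (Fin k)) →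
          subst (λ x → ι (φ x)) s ≡ map ι (subst φ s)
subst-∘ φ ι []      = refl
subst-∘ φ ι (x ∷ s) = cong (ι (φ x) ∷_) (subst-∘ φ ι s)

proposition1p5p3 : ∀ {k} (P : GraphClass k) (s : List (Fin k)) →
    IsSubstitutionRule P s →
    (∃[ n ] Σ (SimpleGraph n) λ G → Σ (Fin k → Fin n) λ φ → P n G φ) →
    (∀ n (G : SimpleGraph n) (φ : Fin k → Fin n) → P n G φ →
      subst φ s ≢ [] × Reduced G (subst φ s)) →
    ¬ IsLocal P s
proposition1p5p3 P s _ (n , G , φ , Gφ∈P) nonemptyReduced local
  with nonemptyReduced n G φ Gφ∈P
... | t≢[] , reduced with reduced-disturbsPendants G t≢[] reduced
...   | c , disturbed = pendantsDisturbed⇒¬≐attachPendants disturbed fixed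
  where
  fixed : lcWord (attachPendants (adj G) c) (map (2 ↑ʳ_) (subst φ s)) ≐ attachPendants (adj G) c
  fixed x y = trans (cong (λ t → lcWord (attachPendants (adj G) c) t x y) (sym (subst-∘ φ (2 ↑ʳ_) s)))
                    (local n G φ Gφ∈P _ (withPendants G c) (2 ↑ʳ_) (withPendants-inducedEmbedding G c) x y)
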